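{- There exists a family $\mathcal{F}\subseteq\mathcal{P}(\mathbb{Z})$ such that $\mathcal{F}=\mathcal{F}^{*}$.
   Context: $\mathbb{Z}$ is the additive group of integers. For $A,B\subseteq\mathbb{Z}$, $A+B=\{a+b:a\in A,b\in B\}$. For $\mathcal{F}\subseteq\mathcal{P}(\mathbb{Z})$, $\mathcal{F}^{*}=\{A\subseteq\mathbb{Z}:\ \forall F\in\mathcal{F}\ \ A+F\neq\mathbb{Z}\}$. -}

module Defs where

open import Level using (0ℓ; suc)
open import Data.Integer using (ℤ; _+_)
open import Data.Product using (∃; ∃₂; _×_; Σ)
open import Relation.Binary.PropositionalEquality using (_≡_)
open import Relation.Nullary using (¬_)
open import Relation.Unary using (Pred)

Subset : Set₁
Subset = Pred ℤ 0ℓ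

Family : Set₂
Family = Pred Subset (suc 0ℓ)

_⊕_ : Subset → Subset → Subset
(A ⊕ B) z = ∃₂ λ a b → A a × B b × (a + b ≡ z)

IsAll : Subset → Set
IsAll S = ∀ z → S z

_* : Family → Family
(𝓕 *) A = ∀ (B : Subset) → 𝓕 B → ¬ IsAll (A ⊕ B)

_≐_ : Family → Family → Set₁
𝓕 ≐ 𝓖 = ∀ (A : Subset) → (𝓕 A → 𝓖 A) × (𝓖 A → 𝓕 A)

{-# OPTIONS --safe #-}
module Submission where

-- Take 𝓕 to be the sets of integers that lie in a single parity class.  A sumset
-- of two such sets again lies in a single parity class, so it misses 0 or 1;
-- hence 𝓕 ⊆ 𝓕*.  Conversely, a set A containing an even and an odd integer
-- satisfies A + 2ℤ = ℤ, and 2ℤ ∈ 𝓕, so such an A is not in 𝓕*.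

open import Defs
open import Data.Integer using (ℤ; 0ℤ; 1ℤ; +_; _+_; _-_; _*_; _/_; _%_)
open import Data.Integer.DivMod using (a≡a%n+[a/n]*n; n%d<d)
open import Data.Integer.Divisibility.Signed
  using (_∣_; divides; _∣?_; ∣-refl; ∣⇒∣ᵤ; ∣m∣n⇒∣m+n; ∣m∣n⇒∣m-n)
open import Data.Integer.Properties using (+-identityˡ; +-minus-telescope)
open import Data.Integer.Tactic.RingSolver using (solve-∀)
open import Data.Nat.Base using (suc; s≤s)
open import Data.Nat.Divisibility using (∣1⇒≡1)
open import Data.Empty using (⊥-elim)
open import Data.Product using (Σ; _,_)
open import Data.Sum using (_⊎_; inj₁; inj₂)
open import Level using (Lift; lift)
open import Relation.Binary.PropositionalEquality using (_≡_; refl; trans; cong; subst)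
open import Relation.Nullary using (¬_; yes; no)

Even : Subset
Even z = + 2 ∣ z

¬even-1 : ¬ Even 1ℤ
¬even-1 2∣1 with ∣1⇒≡1 (∣⇒∣ᵤ 2∣1)
... | ()

even-or-even-suc : ∀ z → Even z ⊎ Even (1ℤ + z)
even-or-even-suc z with z % + 2 | n%d<d z (+ 2) | a≡a%n+[a/n]*n z (+ 2)
... | 0           | _               | z≡0+2q = inj₁ (divides (z / + 2) (trans z≡0+2q (+-identityˡ _)))
... | 1           | _               | z≡1+2q =
  inj₂ (divides (1ℤ + z / + 2) (trans (cong (_+_ 1ℤ) z≡1+2q) (regroup (z / + 2))))
  where
  regroup : ∀ q → 1ℤ + (1ℤ + q * (+ 2)) ≡ (1ℤ + q) * (+ 2)
  regroup = solve-∀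
... | suc (suc _) | s≤s (s≤s ()) | _

odd⇒even-suc : ∀ {z} → ¬ Even z → Even (1ℤ + z)
odd⇒even-suc {z} z-odd with even-or-even-suc z
... | inj₁ z-even = ⊥-elim (z-odd z-even)
... | inj₂ 1+z-even = 1+z-even

odd+odd-even : ∀ {m n} → ¬ Even m → ¬ Even n → Even (m + n)
odd+odd-even {m} {n} m-odd n-odd =
  subst Even (regroup m n) (∣m∣n⇒∣m-n (∣m∣n⇒∣m+n (odd⇒even-suc m-odd) (odd⇒even-suc n-odd)) ∣-refl)
  where
  regroup : ∀ m n → (1ℤ + m) + (1ℤ + n) - + 2 ≡ m + n
  regroup = solve-∀

Homogeneous : Subset → Set
Homogeneous A = ∀ {a b} → A a → A b → Even (a - b)

even-homogeneous : Homogeneous Even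
even-homogeneous = ∣m∣n⇒∣m-n

⊕-homogeneous : ∀ {A B} → Homogeneous A → Homogeneous B → Homogeneous (A ⊕ B)
⊕-homogeneous hA hB (a , b , Aa , Bb , refl) (a′ , b′ , Aa′ , Bb′ , refl) =
  subst Even (regroup a b a′ b′) (∣m∣n⇒∣m+n (hA Aa Aa′) (hB Bb Bb′))
  where
  regroup : ∀ a b a′ b′ → (a - a′) + (b - b′) ≡ (a + b) - (a′ + b′)
  regroup = solve-∀

homogeneous⇒¬IsAll : ∀ {S} → Homogeneous S → ¬ IsAll S
homogeneous⇒¬IsAll hS all = ¬even-1 (hS (all 1ℤ) (all 0ℤ))

i+[j-i]≡j : ∀ i j → i + (j - i) ≡ j
i+[j-i]≡j = solve-∀

mixed-parity⇒⊕-even-IsAll : ∀ {A a b} → A a → A b → ¬ Even (a - b) → IsAll (A ⊕ Even)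
mixed-parity⇒⊕-even-IsAll {a = a} {b} Aa Ab a-b-odd z with + 2 ∣? (z - a)
... | yes z-a-even = a , z - a , Aa , z-a-even , i+[j-i]≡j a z
... | no z-a-odd   = b , z - b , Ab , z-b-even , i+[j-i]≡j b z
  where
  z-b-even : Even (z - b)
  z-b-even = subst Even (+-minus-telescope z a b) (odd+odd-even z-a-odd a-b-odd)

𝓗 : Family
𝓗 A = Lift _ (Homogeneous A)

homogeneous⇒∈𝓗* : ∀ {A} → Homogeneous A → (𝓗 *) A
homogeneous⇒∈𝓗* hA B (lift hB) = homogeneous⇒¬IsAll (⊕-homogeneous hA hB)

∈𝓗*⇒homogeneous : ∀ {A} → (𝓗 *) A → Homogeneous A
∈𝓗*⇒homogeneous A∈𝓗* {a} {b} Aa Ab with + 2 ∣? (a - b)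
... | yes a-b-even = a-b-even
... | no a-b-odd   =
  ⊥-elim (A∈𝓗* Even (lift even-homogeneous) (mixed-parity⇒⊕-even-IsAll Aa Ab a-b-odd))

mainTheorem3 : Σ Family (λ 𝓕 → 𝓕 ≐ (𝓕 *))
mainTheorem3 = 𝓗 , λ A →
  (λ (lift hA) → homogeneous⇒∈𝓗* hA) , (λ A∈𝓗* → lift (∈𝓗*⇒homogeneous A∈𝓗*))
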